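{- Call a set $A\subseteq\mathbb{Z}_n$ ($n$ a positive integer) a counterexample if: $A$ is not contained in a coset of a proper subgroup of $\mathbb{Z}_n$; $|2A|<\min\{\frac94|A|,n\}$; and none of the following holds: (i) $|2A|-|A|\ge C_0^{ -1}n$ with $C_0=2.4\cdot10^4$; (ii) there are a proper subgroup $H<\mathbb{Z}_n$ and an arithmetic progression $P$ with $|P|>1$ such that $A\subseteq P+H$ and $(|P|-1)|H|\le|2A|-|A|$; (iii) there is a proper subgroup $H<\mathbb{Z}_n$ such that $A$ meets exactly three $H$-cosets, these cosets do not form an arithmetic progression in $\mathbb{Z}_n/H$, and $3|H|\le|2A|-|A|$. Suppose a counterexample exists for some $n$; let $n$ be the smallest such positive integer and $A\subseteq\mathbb{Z}_n$ a counterexample. Then $2A$ is aperiodic, i.e. $\{g\in\mathbb{Z}_n\colon 2A+g=2A\}=\{0\}$.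
   Context: $\mathbb{Z}_n$ is the cyclic group of order $n$; $2A=A+A$. An arithmetic progression with $N\ge2$ terms is $\{g,g+d,\dots,g+(N-1)d\}$. -}

module Defs where

open import Data.Nat using (ℕ; zero; suc; _+_; _*_; _∸_; _≤_; _<_)
open import Data.Nat.DivMod using (_%_; m%n<n)
open import Data.Fin using (Fin; toℕ; fromℕ<)
open import Data.Fin.Properties using (any?) renaming (_≟_ to _≟ᶠ_)
open import Data.Fin.Subset using (Subset; _∈_; _∉_; ∣_∣)
open import Data.Fin.Subset.Properties using (_∈?_)
open import Data.Vec using (tabulate)
open import Data.Product using (Σ; ∃; _×_; _,_)
open import Data.Sum using (_⊎_)
open import Relation.Nullary using (¬_)
open import Relation.Nullary.Decidable using (⌊_⌋; _×-dec_)
open import Relation.Binary.PropositionalEquality using (_≡_)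

-- ℤ_n with n = suc m, realised as Fin (suc m) with arithmetic mod n.
ℤ/ : ℕ → Set
ℤ/ m = Fin (suc m)

infixl 6 _⊕_ _⊖_
_⊕_ : ∀ {m} → ℤ/ m → ℤ/ m → ℤ/ m
_⊕_ {m} a b = fromℕ< (m%n<n (toℕ a + toℕ b) (suc m))

⊝_ : ∀ {m} → ℤ/ m → ℤ/ m
⊝_ {m} a = fromℕ< (m%n<n (suc m ∸ toℕ a) (suc m))

_⊖_ : ∀ {m} → ℤ/ m → ℤ/ m → ℤ/ m
a ⊖ b = a ⊕ (⊝ b)

_·_ : ∀ {m} → ℕ → ℤ/ m → ℤ/ m
_·_ {m} k d = fromℕ< (m%n<n (k * toℕ d) (suc m))

_+ˢ_ : ∀ {m} → Subset (suc m) → Subset (suc m) → Subset (suc m)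
A +ˢ B = tabulate λ x → ⌊ any? (λ a → any? (λ b → (a ∈? A) ×-dec ((b ∈? B) ×-dec ((a ⊕ b) ≟ᶠ x)))) ⌋

2·_ : ∀ {m} → Subset (suc m) → Subset (suc m)
2· A = A +ˢ A

_+ᵗ_ : ∀ {m} → Subset (suc m) → ℤ/ m → Subset (suc m)
S +ᵗ g = tabulate λ x → ⌊ (x ⊖ g) ∈? S ⌋

AP : ∀ {m} → ℤ/ m → ℤ/ m → ℕ → Subset (suc m)
AP g d N = tabulate λ x → ⌊ any? {N} (λ i → x ≟ᶠ (g ⊕ (toℕ i · d))) ⌋

IsSubgroup : ∀ {m} → Subset (suc m) → Set
IsSubgroup H = (Fin.zero ∈ H)
  × (∀ a b → a ∈ H → b ∈ H → (a ⊕ b) ∈ H)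
  × (∀ a → a ∈ H → (⊝ a) ∈ H)

IsProper : ∀ {m} → Subset (suc m) → Set
IsProper {m} H = ∃ λ (x : ℤ/ m) → x ∉ H

IsProperSubgroup : ∀ {m} → Subset (suc m) → Set
IsProperSubgroup H = IsSubgroup H × IsProper H

InCosetOf : ∀ {m} → Subset (suc m) → Subset (suc m) → Set
InCosetOf {m} A H = ∃ λ (g : ℤ/ m) → ∀ a → a ∈ A → (a ⊖ g) ∈ H

C₀ : ℕ
C₀ = 24000

-- (i) |2A| - |A| ≥ n / C₀, i.e. n ≤ C₀ (|2A| - |A|)
CaseI : ∀ {m} → Subset (suc m) → Set
CaseI {m} A = suc m + C₀ * ∣ A ∣ ≤ C₀ * ∣ 2· A ∣

CaseII : ∀ {m} → Subset (suc m) → Set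
CaseII {m} A = ∃ λ (H : Subset (suc m)) → IsProperSubgroup H ×
  (∃ λ (g : ℤ/ m) → ∃ λ (d : ℤ/ m) → ∃ λ (N : ℕ) →
     1 < ∣ AP g d N ∣
     × (∀ a → a ∈ A → ∃ λ p → ∃ λ h → p ∈ AP g d N × h ∈ H × a ≡ p ⊕ h)
     × (∣ AP g d N ∣ ∸ 1) * ∣ H ∣ + ∣ A ∣ ≤ ∣ 2· A ∣)

-- the three cosets x+H, y+H, z+H form an arithmetic progression in ℤ_n/H:
-- their union equals ⋃_{i<N} (c + i·δ + H) for some c, δ, N ≥ 2
CosetsFormAP : ∀ {m} → Subset (suc m) → ℤ/ m → ℤ/ m → ℤ/ m → Set
CosetsFormAP {m} H x y z = ∃ λ (c : ℤ/ m) → ∃ λ (δ : ℤ/ m) → ∃ λ (N : ℕ) → 2 ≤ N ×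
  (∀ w → ((w ⊖ x) ∈ H ⊎ (w ⊖ y) ∈ H ⊎ (w ⊖ z) ∈ H)
       → ∃ λ (i : Fin N) → (w ⊖ (c ⊕ (toℕ i · δ))) ∈ H)
  × (∀ w → (∃ λ (i : Fin N) → (w ⊖ (c ⊕ (toℕ i · δ))) ∈ H)
       → ((w ⊖ x) ∈ H ⊎ (w ⊖ y) ∈ H ⊎ (w ⊖ z) ∈ H))

CaseIII : ∀ {m} → Subset (suc m) → Set
CaseIII {m} A = ∃ λ (H : Subset (suc m)) → IsProperSubgroup H ×
  (∃ λ (x : ℤ/ m) → ∃ λ (y : ℤ/ m) → ∃ λ (z : ℤ/ m) →
     x ∈ A × y ∈ A × z ∈ A
     × (x ⊖ y) ∉ H × (x ⊖ z) ∉ H × (y ⊖ z) ∉ H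
     × (∀ a → a ∈ A → (a ⊖ x) ∈ H ⊎ (a ⊖ y) ∈ H ⊎ (a ⊖ z) ∈ H)
     × ¬ CosetsFormAP H x y z
     × 3 * ∣ H ∣ + ∣ A ∣ ≤ ∣ 2· A ∣)

Counterexample : ∀ {m} → Subset (suc m) → Set
Counterexample {m} A =
  ¬ (∃ λ H → IsProperSubgroup H × InCosetOf A H)
  × 4 * ∣ 2· A ∣ < 9 * ∣ A ∣
  × ∣ 2· A ∣ < suc m
  × ¬ CaseI A × ¬ CaseII A × ¬ CaseIII A

Aperiodic : ∀ {m} → Subset (suc m) → Set
Aperiodic {m} S = ∀ (g : ℤ/ m) → S +ᵗ g ≡ S → g ≡ Fin.zero

{-# OPTIONS --safe #-}
-- If 2A has a nonzero period g, it is also invariant under translation by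
-- d = gcd(g, n), a proper divisor of n, so 2A is the full preimage of its
-- image under the reduction π : ℤ_n → ℤ_d, whose fibres have size h = n/d.
-- Hence the image A' = π(A) satisfies |2A| = h|2A'| and |A| ≤ h|A'|.  Every
-- witness (subgroup, coset, progression, triple of cosets) against A' being
-- a counterexample pulls back along π to a witness against A, with all
-- cardinalities multiplied by h; so A' is a counterexample in ℤ_d, d < n,
-- contradicting the minimality of n.
module Submission where

open import Defs
open import Level using (Level)
open import Data.Bool using (Bool; true; false; if_then_else_)
open import Data.Nat using (ℕ; zero; suc; _+_; _*_; _∸_; _≤_; _<_; NonZero; z≤n; s≤s; z<s; s<s; >-nonZero)
open import Data.Nat.Properties
open import Data.Nat.DivMod
open import Data.Nat.Divisibility using (divides; ∣⇒≤; 0∣⇒≡0)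
open import Data.Nat.GCD using (module Bézout; module GCD)
open import Data.Nat.Tactic.RingSolver using (solve-∀)
open import Data.Fin using (Fin; toℕ; fromℕ<)
open import Data.Fin.Properties using (toℕ-fromℕ<; toℕ-injective; toℕ<n; any?) renaming (_≟_ to _≟ᶠ_)
open import Data.Fin.Subset using (Subset; _∈_; _∉_; _⊆_; ∣_∣; Empty)
open import Data.Fin.Subset.Properties using (_∈?_; ⊆-antisym; p⊆q⇒∣p∣≤∣q∣; Empty-unique; ∣⊥∣≡0)
open import Data.Vec using ([]; _∷_; tabulate; lookup)
open import Data.Vec.Properties using ([]=⇒lookup; lookup⇒[]=; lookup∘tabulate)
open import Data.Product using (∃; ∃₂; _×_; _,_)
open import Data.Sum using (_⊎_; inj₁; inj₂) renaming (map to ⊎-map)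
open import Data.Empty using (⊥-elim)
open import Function using (_∘_)
open import Relation.Nullary using (¬_; Dec; yes; no)
open import Relation.Nullary.Decidable using (⌊_⌋; _×-dec_; isYes≗does; dec-true; decidable-stable)
open import Relation.Binary.PropositionalEquality

[m%n+o]%n≡[m+o]%n : ∀ m o n .{{_ : NonZero n}} → (m % n + o) % n ≡ (m + o) % n
[m%n+o]%n≡[m+o]%n m o n = begin
  (m % n + o) % n         ≡⟨ %-distribˡ-+ (m % n) o n ⟩
  (m % n % n + o % n) % n ≡⟨ cong (λ z → (z + o % n) % n) (m%n%n≡m%n m n) ⟩
  (m % n + o % n) % n     ≡⟨ %-distribˡ-+ m o n ⟨
  (m + o) % n             ∎
  where open ≡-Reasoning

[m+o%n]%n≡[m+o]%n : ∀ m o n .{{_ : NonZero n}} → (m + o % n) % n ≡ (m + o) % n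
[m+o%n]%n≡[m+o]%n m o n = begin
  (m + o % n) % n ≡⟨ cong (_% n) (+-comm m (o % n)) ⟩
  (o % n + m) % n ≡⟨ [m%n+o]%n≡[m+o]%n o m n ⟩
  (o + m) % n     ≡⟨ cong (_% n) (+-comm o m) ⟩
  (m + o) % n     ∎
  where open ≡-Reasoning

[m*[o%n]]%n≡[m*o]%n : ∀ m o n .{{_ : NonZero n}} → (m * (o % n)) % n ≡ (m * o) % n
[m*[o%n]]%n≡[m*o]%n m o n = begin
  (m * (o % n)) % n           ≡⟨ %-distribˡ-* m (o % n) n ⟩
  (m % n * (o % n % n)) % n   ≡⟨ cong (λ z → (m % n * z) % n) (m%n%n≡m%n o n) ⟩
  (m % n * (o % n)) % n       ≡⟨ %-distribˡ-* m o n ⟨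
  (m * o) % n                 ∎
  where open ≡-Reasoning

%-cancelʳ-+ : ∀ {a b} o n .{{_ : NonZero n}} → (a + o) % n ≡ (b + o) % n → a % n ≡ b % n
%-cancelʳ-+ {a} {b} o n eq = begin
  a % n                 ≡⟨ undo a ⟨
  (a + o + c) % n       ≡⟨ [m%n+o]%n≡[m+o]%n (a + o) c n ⟨
  ((a + o) % n + c) % n ≡⟨ cong (λ z → (z + c) % n) eq ⟩
  ((b + o) % n + c) % n ≡⟨ [m%n+o]%n≡[m+o]%n (b + o) c n ⟩
  (b + o + c) % n       ≡⟨ undo b ⟩
  b % n                 ∎
  where
  open ≡-Reasoning
  c : ℕ
  c = n ∸ o % n
  o+c≡ : o + c ≡ suc (o / n) * n
  o+c≡ = begin
    o + c                   ≡⟨ cong (_+ c) (m≡m%n+[m/n]*n o n) ⟩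
    o % n + o / n * n + c   ≡⟨ +-assoc (o % n) _ c ⟩
    o % n + (o / n * n + c) ≡⟨ cong (o % n +_) (+-comm (o / n * n) c) ⟩
    o % n + (c + o / n * n) ≡⟨ +-assoc (o % n) c _ ⟨
    o % n + c + o / n * n   ≡⟨ cong (_+ o / n * n) (m+[n∸m]≡n (m%n≤n o n)) ⟩
    n + o / n * n           ∎
  undo : ∀ z → (z + o + c) % n ≡ z % n
  undo z = trans (cong (_% n) (trans (+-assoc z o c) (cong (z +_) o+c≡))) ([m+kn]%n≡m%n z (suc (o / n)) n)

module _ {m : ℕ} where

  toℕ-⊕ : (a b : ℤ/ m) → toℕ (a ⊕ b) ≡ (toℕ a + toℕ b) % suc m
  toℕ-⊕ a b = toℕ-fromℕ< _

  toℕ-⊝ : (a : ℤ/ m) → toℕ (⊝ a) ≡ (suc m ∸ toℕ a) % suc m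
  toℕ-⊝ a = toℕ-fromℕ< _

  toℕ-· : (i : ℕ) (a : ℤ/ m) → toℕ (i · a) ≡ (i * toℕ a) % suc m
  toℕ-· i a = toℕ-fromℕ< _

  toℕ-% : (a : ℤ/ m) → toℕ a % suc m ≡ toℕ a
  toℕ-% a = m<n⇒m%n≡m (toℕ<n a)

  toℕ-⊖ : (a b : ℤ/ m) → toℕ (a ⊖ b) ≡ (toℕ a + (suc m ∸ toℕ b)) % suc m
  toℕ-⊖ a b = begin
    toℕ (a ⊕ ⊝ b)                              ≡⟨ toℕ-⊕ a (⊝ b) ⟩
    (toℕ a + toℕ (⊝ b)) % suc m                ≡⟨ cong (λ z → (toℕ a + z) % suc m) (toℕ-⊝ b) ⟩
    (toℕ a + (suc m ∸ toℕ b) % suc m) % suc m  ≡⟨ [m+o%n]%n≡[m+o]%n (toℕ a) _ (suc m) ⟩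
    (toℕ a + (suc m ∸ toℕ b)) % suc m          ∎
    where open ≡-Reasoning

  +-toℕ-∸-cancel : ∀ x (b : ℤ/ m) → (x + toℕ b + (suc m ∸ toℕ b)) % suc m ≡ x % suc m
  +-toℕ-∸-cancel x b = begin
    (x + toℕ b + (suc m ∸ toℕ b)) % suc m    ≡⟨ cong (_% suc m) (+-assoc x (toℕ b) _) ⟩
    (x + (toℕ b + (suc m ∸ toℕ b))) % suc m  ≡⟨ cong (λ z → (x + z) % suc m) (m+[n∸m]≡n (<⇒≤ (toℕ<n b))) ⟩
    (x + suc m) % suc m                      ≡⟨ [m+n]%n≡m%n x (suc m) ⟩
    x % suc m                                ∎
    where open ≡-Reasoning

  ⊕-comm : (a b : ℤ/ m) → a ⊕ b ≡ b ⊕ a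
  ⊕-comm a b = toℕ-injective (trans (toℕ-⊕ a b) (trans (cong (_% suc m) (+-comm (toℕ a) (toℕ b))) (sym (toℕ-⊕ b a))))

  [x⊕g]⊖g≡x : (x g : ℤ/ m) → (x ⊕ g) ⊖ g ≡ x
  [x⊕g]⊖g≡x x g = toℕ-injective (begin
    toℕ ((x ⊕ g) ⊖ g)                                  ≡⟨ toℕ-⊖ (x ⊕ g) g ⟩
    (toℕ (x ⊕ g) + (suc m ∸ toℕ g)) % suc m            ≡⟨ cong (λ z → (z + (suc m ∸ toℕ g)) % suc m) (toℕ-⊕ x g) ⟩
    ((toℕ x + toℕ g) % suc m + (suc m ∸ toℕ g)) % suc m ≡⟨ [m%n+o]%n≡[m+o]%n (toℕ x + toℕ g) _ (suc m) ⟩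
    (toℕ x + toℕ g + (suc m ∸ toℕ g)) % suc m          ≡⟨ +-toℕ-∸-cancel (toℕ x) g ⟩
    toℕ x % suc m                                      ≡⟨ toℕ-% x ⟩
    toℕ x                                              ∎)
    where open ≡-Reasoning

  p⊕[a⊖p]≡a : (p a : ℤ/ m) → p ⊕ (a ⊖ p) ≡ a
  p⊕[a⊖p]≡a p a = begin
    p ⊕ (a ⊖ p)  ≡⟨ ⊕-comm p (a ⊖ p) ⟩
    (a ⊖ p) ⊕ p  ≡⟨ toℕ-injective (begin
      toℕ ((a ⊖ p) ⊕ p)                                    ≡⟨ toℕ-⊕ (a ⊖ p) p ⟩
      (toℕ (a ⊖ p) + toℕ p) % suc m                        ≡⟨ cong (λ z → (z + toℕ p) % suc m) (toℕ-⊖ a p) ⟩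
      ((toℕ a + (suc m ∸ toℕ p)) % suc m + toℕ p) % suc m  ≡⟨ [m%n+o]%n≡[m+o]%n (toℕ a + _) (toℕ p) (suc m) ⟩
      (toℕ a + (suc m ∸ toℕ p) + toℕ p) % suc m            ≡⟨ cong (_% suc m) (+-assoc (toℕ a) _ (toℕ p)) ⟩
      (toℕ a + ((suc m ∸ toℕ p) + toℕ p)) % suc m          ≡⟨ cong (λ z → (toℕ a + z) % suc m) (+-comm (suc m ∸ toℕ p) (toℕ p)) ⟩
      (toℕ a + (toℕ p + (suc m ∸ toℕ p))) % suc m          ≡⟨ cong (_% suc m) (+-assoc (toℕ a) (toℕ p) _) ⟨
      (toℕ a + toℕ p + (suc m ∸ toℕ p)) % suc m            ≡⟨ +-toℕ-∸-cancel (toℕ a) p ⟩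
      toℕ a % suc m                                        ≡⟨ toℕ-% a ⟩
      toℕ a                                                ∎) ⟩
    a            ∎
    where open ≡-Reasoning

  [p⊕h]⊖p≡h : (p h : ℤ/ m) → (p ⊕ h) ⊖ p ≡ h
  [p⊕h]⊖p≡h p h = trans (cong (_⊖ p) (⊕-comm p h)) ([x⊕g]⊖g≡x h p)

module _ {ℓ : Level} {n : ℕ} {P : Fin n → Set ℓ} (P? : ∀ x → Dec (P x)) where

  ∈-tabulate⁺ : ∀ {x} → P x → x ∈ tabulate (λ y → ⌊ P? y ⌋)
  ∈-tabulate⁺ {x} px = lookup⇒[]= x _ (trans (lookup∘tabulate _ x) (trans (isYes≗does (P? x)) (dec-true (P? x) px)))

  ∈-tabulate⁻ : ∀ {x} → x ∈ tabulate (λ y → ⌊ P? y ⌋) → P x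
  ∈-tabulate⁻ {x} x∈ = witness (P? x) (trans (sym (lookup∘tabulate _ x)) ([]=⇒lookup x∈))
    where
    witness : (a? : Dec (P x)) → ⌊ a? ⌋ ≡ true → P x
    witness (yes a) _ = a
    witness (no _) ()

module _ {m : ℕ} {S : Subset (suc m)} where

  private
    sum? : (x : ℤ/ m) → Dec (∃₂ λ a b → a ∈ S × b ∈ S × a ⊕ b ≡ x)
    sum? x = any? (λ a → any? (λ b → (a ∈? S) ×-dec ((b ∈? S) ×-dec ((a ⊕ b) ≟ᶠ x))))

  ∈-2·⁺ : ∀ {a b} → a ∈ S → b ∈ S → a ⊕ b ∈ 2· S
  ∈-2·⁺ {a} {b} a∈S b∈S = ∈-tabulate⁺ sum? (a , b , a∈S , b∈S , refl)

  ∈-2·⁻ : ∀ {x} → x ∈ 2· S → ∃₂ λ a b → a ∈ S × b ∈ S × a ⊕ b ≡ x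
  ∈-2·⁻ = ∈-tabulate⁻ sum?

lookup-∉ : ∀ {n} {S : Subset n} {x} → x ∉ S → lookup S x ≡ false
lookup-∉ {S = S} {x} x∉S with lookup S x in eq
... | false = refl
... | true  = ⊥-elim (x∉S (lookup⇒[]= x S eq))

lookup-cong-∈ : ∀ {n} {S T : Subset n} x → (x ∈ S → x ∈ T) → (x ∈ T → x ∈ S) → lookup S x ≡ lookup T x
lookup-cong-∈ {S = S} x S→T T→S with x ∈? S
... | yes x∈S = trans ([]=⇒lookup x∈S) (sym ([]=⇒lookup (S→T x∈S)))
... | no  x∉S = trans (lookup-∉ x∉S) (sym (lookup-∉ (x∉S ∘ T→S)))

#[_] : ℕ → (ℕ → Bool) → ℕ
#[ zero  ] f = 0
#[ suc n ] f = (if f 0 then 1 else 0) + #[ n ] (f ∘ suc)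

#-cong : ∀ n {f g : ℕ → Bool} → (∀ i → i < n → f i ≡ g i) → #[ n ] f ≡ #[ n ] g
#-cong zero    f≡g = refl
#-cong (suc n) f≡g =
  cong₂ _+_ (cong (λ b → if b then 1 else 0) (f≡g 0 z<s)) (#-cong n (λ i i<n → f≡g (suc i) (s<s i<n)))

#-+ : ∀ a b (f : ℕ → Bool) → #[ a + b ] f ≡ #[ a ] f + #[ b ] (λ i → f (a + i))
#-+ zero    b f = refl
#-+ (suc a) b f = trans (cong (_ +_) (#-+ a b (f ∘ suc))) (sym (+-assoc (if f 0 then 1 else 0) _ _))

#-periodic : ∀ d .{{_ : NonZero d}} q (F : ℕ → Bool) → #[ q * d ] (λ i → F (i % d)) ≡ q * #[ d ] F
#-periodic d zero    F = refl
#-periodic d (suc q) F = begin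
  #[ d + q * d ] (λ i → F (i % d))                               ≡⟨ #-+ d (q * d) _ ⟩
  #[ d ] (λ i → F (i % d)) + #[ q * d ] (λ i → F ((d + i) % d))  ≡⟨ cong₂ _+_
      (#-cong d (λ i i<d → cong F (m<n⇒m%n≡m i<d)))
      (#-cong (q * d) (λ i _ → cong F (trans (cong (_% d) (+-comm d i)) ([m+n]%n≡m%n i d)))) ⟩
  #[ d ] F + #[ q * d ] (λ i → F (i % d))                        ≡⟨ cong (#[ d ] F +_) (#-periodic d q F) ⟩
  #[ d ] F + q * #[ d ] F                                        ∎
  where open ≡-Reasoning

#-insert : ∀ n p (f g : ℕ → Bool) → p < n → f p ≡ true → g p ≡ false
         → (∀ i → i < n → i ≢ p → f i ≡ g i) → #[ n ] f ≡ suc (#[ n ] g)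
#-insert (suc n) zero f g _ fp gp f≡g rewrite fp | gp =
  cong suc (#-cong n (λ i i<n → f≡g (suc i) (s<s i<n) (λ ())))
#-insert (suc n) (suc p) f g (s<s p<n) fp gp f≡g = trans
  (cong₂ _+_ (cong (λ b → if b then 1 else 0) (f≡g 0 z<s (λ ())))
             (#-insert n p (f ∘ suc) (g ∘ suc) p<n fp gp (λ i i<n i≢p → f≡g (suc i) (s<s i<n) (i≢p ∘ suc-injective))))
  (+-suc _ _)

lookupℕ : ∀ {n} → Subset n → ℕ → Bool
lookupℕ []      _       = false
lookupℕ (b ∷ S) zero    = b
lookupℕ (b ∷ S) (suc i) = lookupℕ S i

∣S∣≡#lookupℕ : ∀ {n} (S : Subset n) → ∣ S ∣ ≡ #[ n ] (lookupℕ S)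
∣S∣≡#lookupℕ []          = refl
∣S∣≡#lookupℕ (true ∷ S)  = cong suc (∣S∣≡#lookupℕ S)
∣S∣≡#lookupℕ (false ∷ S) = ∣S∣≡#lookupℕ S

lookupℕ-toℕ : ∀ {n} (S : Subset n) (j : Fin n) → lookupℕ S (toℕ j) ≡ lookup S j
lookupℕ-toℕ (b ∷ S) Fin.zero    = refl
lookupℕ-toℕ (b ∷ S) (Fin.suc j) = lookupℕ-toℕ S j

lookupℕ-fromℕ< : ∀ {n} (S : Subset n) {i} (i<n : i < n) → lookupℕ S i ≡ lookup S (fromℕ< i<n)
lookupℕ-fromℕ< S i<n = trans (cong (lookupℕ S) (sym (toℕ-fromℕ< i<n))) (lookupℕ-toℕ S (fromℕ< i<n))

∣∣-insert : ∀ {n} {S T : Subset n} {p} → T ⊆ S → (∀ {x} → x ∈ S → x ≢ p → x ∈ T)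
          → p ∈ S → p ∉ T → ∣ S ∣ ≡ suc ∣ T ∣
∣∣-insert {n} {S} {T} {p} T⊆S S⊆T+p p∈S p∉T = begin
  ∣ S ∣                   ≡⟨ ∣S∣≡#lookupℕ S ⟩
  #[ n ] (lookupℕ S)       ≡⟨ #-insert n (toℕ p) _ _ (toℕ<n p) S-at-p T-at-p agree ⟩
  suc (#[ n ] (lookupℕ T)) ≡⟨ cong suc (∣S∣≡#lookupℕ T) ⟨
  suc ∣ T ∣                ∎
  where
  open ≡-Reasoning
  S-at-p : lookupℕ S (toℕ p) ≡ true
  S-at-p = trans (lookupℕ-toℕ S p) ([]=⇒lookup p∈S)
  T-at-p : lookupℕ T (toℕ p) ≡ false
  T-at-p = trans (lookupℕ-toℕ T p) (lookup-∉ p∉T)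
  agree : ∀ i → i < n → i ≢ toℕ p → lookupℕ S i ≡ lookupℕ T i
  agree i i<n i≢p = begin
    lookupℕ S i            ≡⟨ lookupℕ-fromℕ< S i<n ⟩
    lookup S (fromℕ< i<n)  ≡⟨ lookup-cong-∈ (fromℕ< i<n) (λ x∈S → S⊆T+p x∈S x≢p) T⊆S ⟩
    lookup T (fromℕ< i<n)  ≡⟨ lookupℕ-fromℕ< T i<n ⟨
    lookupℕ T i            ∎
    where
    x≢p : fromℕ< i<n ≢ p
    x≢p x≡p = i≢p (trans (sym (toℕ-fromℕ< i<n)) (cong toℕ x≡p))

module Progression {m : ℕ} (g δ : ℤ/ m) where

  term : ℕ → ℤ/ m
  term i = g ⊕ (i · δ)

  toℕ-term : ∀ i → toℕ (term i) ≡ (toℕ g + i * toℕ δ) % suc m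
  toℕ-term i = trans (toℕ-⊕ g (i · δ))
    (trans (cong (λ z → (toℕ g + z) % suc m) (toℕ-· i δ)) ([m+o%n]%n≡[m+o]%n (toℕ g) (i * toℕ δ) (suc m)))

  term-suc : ∀ i → term (suc i) ≡ term i ⊕ δ
  term-suc i = toℕ-injective (begin
    toℕ (term (suc i))                             ≡⟨ toℕ-term (suc i) ⟩
    (G + (D + i * D)) % suc m                      ≡⟨ cong (_% suc m) (trans (cong (G +_) (+-comm D (i * D))) (sym (+-assoc G (i * D) D))) ⟩
    (G + i * D + D) % suc m                        ≡⟨ [m%n+o]%n≡[m+o]%n (G + i * D) D (suc m) ⟨
    ((G + i * D) % suc m + D) % suc m              ≡⟨ cong (λ z → (z + D) % suc m) (toℕ-term i) ⟨
    (toℕ (term i) + D) % suc m                     ≡⟨ toℕ-⊕ (term i) δ ⟨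
    toℕ (term i ⊕ δ)                               ∎)
    where
    open ≡-Reasoning
    G D : ℕ
    G = toℕ g
    D = toℕ δ

  term-suc-cong : ∀ i j → term i ≡ term j → term (suc i) ≡ term (suc j)
  term-suc-cong i j ti≡tj = trans (term-suc i) (trans (cong (_⊕ δ) ti≡tj) (sym (term-suc j)))

  private
    at? : ∀ N (x : ℤ/ m) → Dec (∃ λ (i : Fin N) → x ≡ g ⊕ (toℕ i · δ))
    at? N x = any? (λ i → x ≟ᶠ (g ⊕ (toℕ i · δ)))

  ∈-AP⁺ : ∀ {N} i → i < N → term i ∈ AP g δ N
  ∈-AP⁺ i i<N = ∈-tabulate⁺ (at? _) (fromℕ< i<N , cong term (sym (toℕ-fromℕ< i<N)))

  ∈-AP⁻ : ∀ N {x} → x ∈ AP g δ N → ∃ λ i → i < N × x ≡ term i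
  ∈-AP⁻ N x∈ with ∈-tabulate⁻ (at? _) x∈
  ... | i , x≡ = toℕ i , toℕ<n i , x≡

  AP-mono : ∀ {N N'} → N ≤ N' → AP g δ N ⊆ AP g δ N'
  AP-mono {N} N≤N' x∈ with ∈-AP⁻ N x∈
  ... | i , i<N , refl = ∈-AP⁺ i (<-≤-trans i<N N≤N')

  AP-suc-⊆ : ∀ {N x} → x ∈ AP g δ (suc N) → x ≢ term N → x ∈ AP g δ N
  AP-suc-⊆ {N} x∈ x≢tN with ∈-AP⁻ (suc N) x∈
  ... | i , i<1+N , refl with m≤n⇒m<n∨m≡n i<1+N
  ... | inj₁ (s≤s i<N) = ∈-AP⁺ i i<N
  ... | inj₂ refl      = ⊥-elim (x≢tN refl)

  AP-zero-empty : Empty (AP g δ 0)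
  AP-zero-empty (x , x∈) with ∈-AP⁻ 0 x∈
  ... | _ , () , _

  AP-closed : ∀ {j} → term j ∈ AP g δ j → ∀ i → term i ∈ AP g δ j
  AP-closed {j} tj∈ zero with ∈-AP⁻ j tj∈
  ... | a , a<j , _ = ∈-AP⁺ 0 (≤-<-trans z≤n a<j)
  AP-closed {j} tj∈ (suc i) with ∈-AP⁻ j (AP-closed tj∈ i)
  ... | b , b<j , ti≡tb with m≤n⇒m<n∨m≡n b<j
  ... | inj₁ 1+b<j = subst (_∈ AP g δ j) (sym (term-suc-cong i b ti≡tb)) (∈-AP⁺ (suc b) 1+b<j)
  ... | inj₂ refl  = subst (_∈ AP g δ j) (sym (term-suc-cong i b ti≡tb)) tj∈

  Distinct : ℕ → Set
  Distinct N = ∀ i → i < N → term i ∉ AP g δ i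

  distinct-or-repeat : ∀ N → Distinct N ⊎ ∃ λ j → j < N × Distinct j × term j ∈ AP g δ j
  distinct-or-repeat zero = inj₁ (λ _ ())
  distinct-or-repeat (suc N) with distinct-or-repeat N
  ... | inj₂ (j , j<N , dj , tj∈) = inj₂ (j , m≤n⇒m≤1+n j<N , dj , tj∈)
  ... | inj₁ dN with term N ∈? AP g δ N
  ...   | yes tN∈ = inj₂ (N , ≤-refl , dN , tN∈)
  ...   | no  tN∉ = inj₁ d1+N
    where
    d1+N : Distinct (suc N)
    d1+N i i<1+N with m≤n⇒m<n∨m≡n i<1+N
    ... | inj₁ (s≤s i<N) = dN i i<N
    ... | inj₂ refl      = tN∉

  ∣AP∣≡ : ∀ {N} → Distinct N → ∣ AP g δ N ∣ ≡ N
  ∣AP∣≡ {zero}  _  = trans (cong ∣_∣ (Empty-unique AP-zero-empty)) (∣⊥∣≡0 (suc m))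
  ∣AP∣≡ {suc N} dN = trans
    (∣∣-insert (AP-mono (n≤1+n N)) AP-suc-⊆ (∈-AP⁺ N ≤-refl) (dN N ≤-refl))
    (cong suc (∣AP∣≡ (λ i i<N → dN i (m≤n⇒m≤1+n i<N))))

  AP-trim : ∀ N → ∃ λ M → Distinct M × AP g δ M ≡ AP g δ N
  AP-trim N with distinct-or-repeat N
  ... | inj₁ dN = N , dN , refl
  ... | inj₂ (j , j<N , dj , tj∈) = j , dj , ⊆-antisym (AP-mono (<⇒≤ j<N)) APN⊆APj
    where
    APN⊆APj : AP g δ N ⊆ AP g δ j
    APN⊆APj x∈ with ∈-AP⁻ N x∈
    ... | i , _ , refl = AP-closed tj∈ i

-- d = suc k is a proper divisor of n = suc m, and S is a union of cosets of dℤ_n.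
record ResidueDetermined {m : ℕ} (S : Subset (suc m)) : Set where
  field
    k h    : ℕ
    n≡h*d  : suc m ≡ h * suc k
    k<m    : k < m
    closed : ∀ x y → toℕ x % suc k ≡ toℕ y % suc k → x ∈ S → y ∈ S

module Shift {m : ℕ} (S : Subset (suc m)) where

  shift : ℕ → ℤ/ m → ℤ/ m
  shift c x = fromℕ< (m%n<n (toℕ x + c) (suc m))

  toℕ-shift : ∀ c x → toℕ (shift c x) ≡ (toℕ x + c) % suc m
  toℕ-shift c x = toℕ-fromℕ< _

  ShiftInvariant : ℕ → Set
  ShiftInvariant c = ∀ {x} → x ∈ S → shift c x ∈ S

  period⇒shiftInvariant : ∀ {g} → S +ᵗ g ≡ S → ShiftInvariant (toℕ g)
  period⇒shiftInvariant {g} S+g≡S {x} x∈S = subst (x ⊕ g ∈_) S+g≡S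
    (∈-tabulate⁺ (λ y → (y ⊖ g) ∈? S) (subst (_∈ S) (sym ([x⊕g]⊖g≡x x g)) x∈S))

  shiftInvariant-% : ∀ {c c'} → c % suc m ≡ c' % suc m → ShiftInvariant c → ShiftInvariant c'
  shiftInvariant-% {c} {c'} c≡c' inv {x} x∈S = subst (_∈ S) (toℕ-injective (begin
    toℕ (shift c x)              ≡⟨ toℕ-shift c x ⟩
    (toℕ x + c) % suc m          ≡⟨ [m+o%n]%n≡[m+o]%n (toℕ x) c (suc m) ⟨
    (toℕ x + c % suc m) % suc m  ≡⟨ cong (λ z → (toℕ x + z) % suc m) c≡c' ⟩
    (toℕ x + c' % suc m) % suc m ≡⟨ [m+o%n]%n≡[m+o]%n (toℕ x) c' (suc m) ⟩
    (toℕ x + c') % suc m         ≡⟨ toℕ-shift c' x ⟨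
    toℕ (shift c' x)             ∎)) (inv x∈S)
    where open ≡-Reasoning

  shiftInvariant-0 : ShiftInvariant 0
  shiftInvariant-0 {x} = subst (_∈ S) (sym (toℕ-injective
    (trans (toℕ-shift 0 x) (trans (cong (_% suc m) (+-identityʳ (toℕ x))) (toℕ-% x)))))

  shiftInvariant-+ : ∀ {a b} → ShiftInvariant a → ShiftInvariant b → ShiftInvariant (a + b)
  shiftInvariant-+ {a} {b} inv-a inv-b {x} x∈S = subst (_∈ S) (toℕ-injective (begin
    toℕ (shift a (shift b x))         ≡⟨ toℕ-shift a (shift b x) ⟩
    (toℕ (shift b x) + a) % suc m     ≡⟨ cong (λ z → (z + a) % suc m) (toℕ-shift b x) ⟩
    ((toℕ x + b) % suc m + a) % suc m ≡⟨ [m%n+o]%n≡[m+o]%n (toℕ x + b) a (suc m) ⟩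
    (toℕ x + b + a) % suc m           ≡⟨ cong (_% suc m) (trans (+-assoc (toℕ x) b a) (cong (toℕ x +_) (+-comm b a))) ⟩
    (toℕ x + (a + b)) % suc m         ≡⟨ toℕ-shift (a + b) x ⟨
    toℕ (shift (a + b) x)             ∎)) (inv-a (inv-b x∈S))
    where open ≡-Reasoning

  shiftInvariant-* : ∀ {c} → ShiftInvariant c → ∀ j → ShiftInvariant (j * c)
  shiftInvariant-* inv zero    = shiftInvariant-0
  shiftInvariant-* inv (suc j) = shiftInvariant-+ inv (shiftInvariant-* inv j)

  shiftInvariant-bézout : ∀ {d G} → ShiftInvariant G → Bézout.Identity d G (suc m) → ShiftInvariant d
  shiftInvariant-bézout {d} {G} inv (Bézout.+- x y d+yn≡xG) =
    shiftInvariant-% (trans (cong (_% suc m) (sym d+yn≡xG)) ([m+kn]%n≡m%n d y (suc m))) (shiftInvariant-* inv x)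
  shiftInvariant-bézout {d} {G} inv (Bézout.-+ x y d+xG≡yn) =
    shiftInvariant-% (begin
      (m * x * G) % suc m               ≡⟨ [m+kn]%n≡m%n (m * x * G) y (suc m) ⟨
      (m * x * G + y * suc m) % suc m   ≡⟨ cong (λ z → (m * x * G + z) % suc m) (sym d+xG≡yn) ⟩
      (m * x * G + (d + x * G)) % suc m ≡⟨ cong (_% suc m) (rearrange m x G d) ⟩
      (d + x * G * suc m) % suc m       ≡⟨ [m+kn]%n≡m%n d (x * G) (suc m) ⟩
      d % suc m                         ∎)
    (shiftInvariant-* inv (m * x))
    where
    open ≡-Reasoning
    rearrange : ∀ m x G d → m * x * G + (d + x * G) ≡ d + x * G * suc m
    rearrange = solve-∀

  -- To reach y from x, shift by a multiple t*d with x + t*d = y + n.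
  shiftInvariant⇒residueClosed : ∀ {h d} .{{_ : NonZero d}} → suc m ≡ h * d → ShiftInvariant d
    → ∀ x y → toℕ x % d ≡ toℕ y % d → x ∈ S → y ∈ S
  shiftInvariant⇒residueClosed {h} {d} n≡h*d inv x y x≡y x∈S =
    subst (_∈ S) shift-x≡y (shiftInvariant-* inv t x∈S)
    where
    X Y : ℕ
    X = toℕ x
    Y = toℕ y
    X/d<h : X / d < h
    X/d<h = m<n*o⇒m/o<n (subst (X <_) n≡h*d (toℕ<n x))
    t : ℕ
    t = Y / d + (h ∸ X / d)
    regroup : ∀ a b c e d → a + b * d + (c + e) * d ≡ (a + c * d) + (b + e) * d
    regroup = solve-∀
    x+td≡y+n : X + t * d ≡ Y + suc m
    x+td≡y+n = begin
      X + t * d                                         ≡⟨ cong (_+ t * d) (m≡m%n+[m/n]*n X d) ⟩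
      X % d + X / d * d + (Y / d + (h ∸ X / d)) * d     ≡⟨ regroup (X % d) (X / d) (Y / d) (h ∸ X / d) d ⟩
      (X % d + Y / d * d) + (X / d + (h ∸ X / d)) * d   ≡⟨ cong₂ (λ u v → (u + Y / d * d) + v * d) x≡y (m+[n∸m]≡n (<⇒≤ X/d<h)) ⟩
      (Y % d + Y / d * d) + h * d                       ≡⟨ cong₂ _+_ (sym (m≡m%n+[m/n]*n Y d)) (sym n≡h*d) ⟩
      Y + suc m                                         ∎
      where open ≡-Reasoning
    shift-x≡y : shift (t * d) x ≡ y
    shift-x≡y = toℕ-injective
      (trans (toℕ-shift (t * d) x) (trans (cong (_% suc m) x+td≡y+n) (trans ([m+n]%n≡m%n Y (suc m)) (toℕ-% y))))

  period⇒residueDetermined : ∀ g → g ≢ Fin.zero → S +ᵗ g ≡ S → ResidueDetermined S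
  period⇒residueDetermined g g≢0 S+g≡S with Bézout.lemma (toℕ g) (suc m)
  ... | Bézout.result zero gcd _ = ⊥-elim (1+n≢0 (0∣⇒≡0 (GCD.gcd∣n gcd)))
  ... | Bézout.result (suc k) gcd bézout with GCD.gcd∣n gcd
  ...   | divides h n≡h*d = record
    { k = k ; h = h ; n≡h*d = n≡h*d
    ; k<m = ≤-pred (<-≤-trans (s≤s d≤g) (toℕ<n g))
    ; closed = shiftInvariant⇒residueClosed {h} n≡h*d (shiftInvariant-bézout (period⇒shiftInvariant S+g≡S) bézout)
    }
    where
    0<toℕ : ∀ {a : ℤ/ m} → a ≢ Fin.zero → 0 < toℕ a
    0<toℕ {Fin.zero}  a≢0 = ⊥-elim (a≢0 refl)
    0<toℕ {Fin.suc _} _   = z<s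
    d≤g : suc k ≤ toℕ g
    d≤g = ∣⇒≤ {{>-nonZero (0<toℕ g≢0)}} (GCD.gcd∣m gcd)

-- Definitionally the tail of CaseIII A after the choice of H and x, y, z ∈ A.
CaseIII-cosets : ∀ {m} → Subset (suc m) → Subset (suc m) → (x y z : ℤ/ m) → Set
CaseIII-cosets A H x y z =
  (x ⊖ y) ∉ H × (x ⊖ z) ∉ H × (y ⊖ z) ∉ H
  × (∀ a → a ∈ A → (a ⊖ x) ∈ H ⊎ (a ⊖ y) ∈ H ⊎ (a ⊖ z) ∈ H)
  × ¬ CosetsFormAP H x y z
  × 3 * ∣ H ∣ + ∣ A ∣ ≤ ∣ 2· A ∣

module Reduction (m k h : ℕ) (n≡h*d : suc m ≡ h * suc k) where

  private
    n d : ℕ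
    n = suc m
    d = suc k

  π : ℤ/ m → ℤ/ k
  π x = fromℕ< (m%n<n (toℕ x) d)

  toℕ-π : ∀ x → toℕ (π x) ≡ toℕ x % d
  toℕ-π x = toℕ-fromℕ< _

  π-≡⇒%-≡ : ∀ {x y} → π x ≡ π y → toℕ x % d ≡ toℕ y % d
  π-≡⇒%-≡ {x} {y} πx≡πy = trans (sym (toℕ-π x)) (trans (cong toℕ πx≡πy) (toℕ-π y))

  ι : ℤ/ k → ℤ/ m
  ι y = fromℕ< (<-≤-trans (toℕ<n y) (∣⇒≤ (divides h n≡h*d)))

  toℕ-ι : ∀ y → toℕ (ι y) ≡ toℕ y
  toℕ-ι y = toℕ-fromℕ< _

  π∘ι : ∀ y → π (ι y) ≡ y
  π∘ι y = toℕ-injective (trans (toℕ-π (ι y)) (trans (cong (_% d) (toℕ-ι y)) (toℕ-% y)))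

  [o%n]%d≡o%d : ∀ o → o % n % d ≡ o % d
  [o%n]%d≡o%d o = m∣n⇒o%n%m≡o%m d n o (divides h n≡h*d)

  π-0 : π Fin.zero ≡ Fin.zero
  π-0 = toℕ-injective (toℕ-π Fin.zero)

  π-⊕ : ∀ a b → π (a ⊕ b) ≡ π a ⊕ π b
  π-⊕ a b = toℕ-injective (begin
    toℕ (π (a ⊕ b))                    ≡⟨ toℕ-π (a ⊕ b) ⟩
    toℕ (a ⊕ b) % d                    ≡⟨ cong (_% d) (toℕ-⊕ a b) ⟩
    (toℕ a + toℕ b) % n % d            ≡⟨ [o%n]%d≡o%d (toℕ a + toℕ b) ⟩
    (toℕ a + toℕ b) % d                ≡⟨ %-distribˡ-+ (toℕ a) (toℕ b) d ⟩
    (toℕ a % d + toℕ b % d) % d        ≡⟨ cong₂ (λ u v → (u + v) % d) (toℕ-π a) (toℕ-π b) ⟨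
    (toℕ (π a) + toℕ (π b)) % d        ≡⟨ toℕ-⊕ (π a) (π b) ⟨
    toℕ (π a ⊕ π b)                    ∎)
    where open ≡-Reasoning

  π-· : ∀ i a → π (i · a) ≡ i · π a
  π-· i a = toℕ-injective (begin
    toℕ (π (i · a))         ≡⟨ toℕ-π (i · a) ⟩
    toℕ (i · a) % d         ≡⟨ cong (_% d) (toℕ-· i a) ⟩
    (i * toℕ a) % n % d     ≡⟨ [o%n]%d≡o%d (i * toℕ a) ⟩
    (i * toℕ a) % d         ≡⟨ [m*[o%n]]%n≡[m*o]%n i (toℕ a) d ⟨
    (i * (toℕ a % d)) % d   ≡⟨ cong (λ z → (i * z) % d) (toℕ-π a) ⟨
    (i * toℕ (π a)) % d     ≡⟨ toℕ-· i (π a) ⟨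
    toℕ (i · π a)           ∎)
    where open ≡-Reasoning

  -- Both n ∸ a and d ∸ (a % d) add up with a to a multiple of d.
  π-⊝ : ∀ a → π (⊝ a) ≡ ⊝ π a
  π-⊝ a = toℕ-injective (begin
    toℕ (π (⊝ a))       ≡⟨ toℕ-π (⊝ a) ⟩
    toℕ (⊝ a) % d       ≡⟨ cong (_% d) (toℕ-⊝ a) ⟩
    (n ∸ A) % n % d     ≡⟨ [o%n]%d≡o%d (n ∸ A) ⟩
    (n ∸ A) % d         ≡⟨ %-cancelʳ-+ {n ∸ A} {d ∸ A % d} A d (trans n∸A+A≡0 (sym d∸A%d+A≡0)) ⟩
    (d ∸ A % d) % d     ≡⟨ cong (λ z → (d ∸ z) % d) (toℕ-π a) ⟨
    (d ∸ toℕ (π a)) % d ≡⟨ toℕ-⊝ (π a) ⟨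
    toℕ (⊝ π a)         ∎)
    where
    open ≡-Reasoning
    A : ℕ
    A = toℕ a
    n∸A+A≡0 : (n ∸ A + A) % d ≡ 0
    n∸A+A≡0 = trans (cong (_% d) (trans (m∸n+n≡m (<⇒≤ (toℕ<n a))) n≡h*d)) (m*n%n≡0 h d)
    d∸A%d+A≡0 : (d ∸ A % d + A) % d ≡ 0
    d∸A%d+A≡0 = trans (sym ([m+o%n]%n≡[m+o]%n (d ∸ A % d) A d)) (trans (cong (_% d) (m∸n+n≡m (m%n≤n A d))) (n%n≡0 d))

  π-⊖ : ∀ a b → π (a ⊖ b) ≡ π a ⊖ π b
  π-⊖ a b = trans (π-⊕ a (⊝ b)) (cong (π a ⊕_) (π-⊝ b))

  π⁻¹ : Subset d → Subset n
  π⁻¹ S' = tabulate (λ x → lookup S' (π x))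

  ∈π⁻¹⁺ : ∀ {S' x} → π x ∈ S' → x ∈ π⁻¹ S'
  ∈π⁻¹⁺ {S'} {x} πx∈ = lookup⇒[]= x (π⁻¹ S') (trans (lookup∘tabulate (λ y → lookup S' (π y)) x) ([]=⇒lookup πx∈))

  ∈π⁻¹⁻ : ∀ S' {x} → x ∈ π⁻¹ S' → π x ∈ S'
  ∈π⁻¹⁻ S' {x} x∈ = lookup⇒[]= (π x) S' (trans (sym (lookup∘tabulate (λ y → lookup S' (π y)) x)) ([]=⇒lookup x∈))

  ∈π⁻¹-⊖⁺ : ∀ {H'} w v → (π w ⊖ π v) ∈ H' → (w ⊖ v) ∈ π⁻¹ H'
  ∈π⁻¹-⊖⁺ {H'} w v ∈H' = ∈π⁻¹⁺ (subst (_∈ H') (sym (π-⊖ w v)) ∈H')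

  ∈π⁻¹-⊖⁻ : ∀ H' w v → (w ⊖ v) ∈ π⁻¹ H' → (π w ⊖ π v) ∈ H'
  ∈π⁻¹-⊖⁻ H' w v ∈π⁻¹H' = subst (_∈ H') (π-⊖ w v) (∈π⁻¹⁻ H' ∈π⁻¹H')

  ∣π⁻¹∣ : ∀ S' → ∣ π⁻¹ S' ∣ ≡ h * ∣ S' ∣
  ∣π⁻¹∣ S' = begin
    ∣ π⁻¹ S' ∣                             ≡⟨ ∣S∣≡#lookupℕ (π⁻¹ S') ⟩
    #[ n ] (lookupℕ (π⁻¹ S'))              ≡⟨ #-cong n residue ⟩
    #[ n ] (λ i → lookupℕ S' (i % d))      ≡⟨ cong (λ z → #[ z ] (λ i → lookupℕ S' (i % d))) n≡h*d ⟩
    #[ h * d ] (λ i → lookupℕ S' (i % d))  ≡⟨ #-periodic d h (lookupℕ S') ⟩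
    h * #[ d ] (lookupℕ S')                ≡⟨ cong (h *_) (∣S∣≡#lookupℕ S') ⟨
    h * ∣ S' ∣                             ∎
    where
    open ≡-Reasoning
    residue : ∀ i → i < n → lookupℕ (π⁻¹ S') i ≡ lookupℕ S' (i % d)
    residue i i<n = begin
      lookupℕ (π⁻¹ S') i                 ≡⟨ lookupℕ-fromℕ< (π⁻¹ S') i<n ⟩
      lookup (π⁻¹ S') (fromℕ< i<n)       ≡⟨ lookup∘tabulate (λ x → lookup S' (π x)) (fromℕ< i<n) ⟩
      lookup S' (π (fromℕ< i<n))         ≡⟨ lookupℕ-toℕ S' (π (fromℕ< i<n)) ⟨
      lookupℕ S' (toℕ (π (fromℕ< i<n)))  ≡⟨ cong (lookupℕ S') (trans (toℕ-π (fromℕ< i<n)) (cong (_% d) (toℕ-fromℕ< i<n))) ⟩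
      lookupℕ S' (i % d)                 ∎

  π⁻¹-properSubgroup : ∀ {H'} → IsProperSubgroup H' → IsProperSubgroup (π⁻¹ H')
  π⁻¹-properSubgroup {H'} ((0∈ , ⊕-closed , ⊝-closed) , x' , x'∉) =
    ( ∈π⁻¹⁺ (subst (_∈ H') (sym π-0) 0∈)
    , (λ a b a∈ b∈ → ∈π⁻¹⁺ (subst (_∈ H') (sym (π-⊕ a b)) (⊕-closed _ _ (∈π⁻¹⁻ H' a∈) (∈π⁻¹⁻ H' b∈))))
    , (λ a a∈ → ∈π⁻¹⁺ (subst (_∈ H') (sym (π-⊝ a)) (⊝-closed _ (∈π⁻¹⁻ H' a∈)))))
    , ι x' , λ ιx'∈ → x'∉ (subst (_∈ H') (π∘ι x') (∈π⁻¹⁻ H' ιx'∈))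

  π-CosetsFormAP : ∀ {H' x y z} → CosetsFormAP (π⁻¹ H') x y z → CosetsFormAP H' (π x) (π y) (π z)
  π-CosetsFormAP {H'} {x} {y} {z} (c , δ , N , 2≤N , cover , within) = π c , π δ , N , 2≤N , cover' , within'
    where
    π-term : ∀ j → π (c ⊕ (j · δ)) ≡ π c ⊕ (j · π δ)
    π-term j = trans (π-⊕ c (j · δ)) (cong (π c ⊕_) (π-· j δ))
    up : ∀ w' v → (w' ⊖ π v) ∈ H' → (ι w' ⊖ v) ∈ π⁻¹ H'
    up w' v ∈H' = ∈π⁻¹-⊖⁺ (ι w') v (subst (λ q → (q ⊖ π v) ∈ H') (sym (π∘ι w')) ∈H')
    down : ∀ w' v → (ι w' ⊖ v) ∈ π⁻¹ H' → (w' ⊖ π v) ∈ H'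
    down w' v ∈π⁻¹H' = subst (λ q → (q ⊖ π v) ∈ H') (π∘ι w') (∈π⁻¹-⊖⁻ H' (ι w') v ∈π⁻¹H')
    cover' : ∀ w' → ((w' ⊖ π x) ∈ H' ⊎ (w' ⊖ π y) ∈ H' ⊎ (w' ⊖ π z) ∈ H')
           → ∃ λ (i : Fin N) → (w' ⊖ (π c ⊕ (toℕ i · π δ))) ∈ H'
    cover' w' in-xyz with cover (ι w') (⊎-map (up w' x) (⊎-map (up w' y) (up w' z)) in-xyz)
    ... | i , ∈π⁻¹H' = i , subst (λ q → (w' ⊖ q) ∈ H') (π-term (toℕ i)) (down w' (c ⊕ (toℕ i · δ)) ∈π⁻¹H')
    within' : ∀ w' → (∃ λ (i : Fin N) → (w' ⊖ (π c ⊕ (toℕ i · π δ))) ∈ H')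
            → ((w' ⊖ π x) ∈ H' ⊎ (w' ⊖ π y) ∈ H' ⊎ (w' ⊖ π z) ∈ H')
    within' w' (i , ∈H') = ⊎-map (down w' x) (⊎-map (down w' y) (down w' z))
      (within (ι w') (i , up w' (c ⊕ (toℕ i · δ)) (subst (λ q → (w' ⊖ q) ∈ H') (sym (π-term (toℕ i))) ∈H')))

  record LiftedAP (g' δ' : ℤ/ k) (N : ℕ) : Set where
    field
      M          : ℕ
      ∣AP∣≡∣AP'∣ : ∣ AP (ι g') (ι δ') M ∣ ≡ ∣ AP g' δ' N ∣
      lift       : ∀ {p'} → p' ∈ AP g' δ' N → ∃ λ p → p ∈ AP (ι g') (ι δ') M × π p ≡ p'

  -- Lift the shortest repetition-free description of the progression, so that
  -- the lift has exactly as many elements as the progression it covers.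
  lift-AP : ∀ (g' δ' : ℤ/ k) N → LiftedAP g' δ' N
  lift-AP g' δ' N with Progression.AP-trim g' δ' N
  ... | M , distinct' , AP'M≡AP'N = record { M = M ; ∣AP∣≡∣AP'∣ = ∣AP∣≡∣AP'∣ ; lift = lift }
    where
    module P' = Progression g' δ'
    module P  = Progression (ι g') (ι δ')
    π-term : ∀ i → π (P.term i) ≡ P'.term i
    π-term i = trans (π-⊕ (ι g') (i · ι δ')) (cong₂ _⊕_ (π∘ι g') (trans (π-· i (ι δ')) (cong (i ·_) (π∘ι δ'))))
    distinct : P.Distinct M
    distinct i i<M ti∈ with P.∈-AP⁻ i ti∈
    ... | j , j<i , ti≡tj = distinct' i i<M
      (subst (_∈ AP g' δ' i) (trans (sym (π-term j)) (trans (cong π (sym ti≡tj)) (π-term i))) (P'.∈-AP⁺ j j<i))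
    ∣AP∣≡∣AP'∣ : ∣ AP (ι g') (ι δ') M ∣ ≡ ∣ AP g' δ' N ∣
    ∣AP∣≡∣AP'∣ = trans (P.∣AP∣≡ distinct) (trans (sym (P'.∣AP∣≡ distinct')) (cong ∣_∣ AP'M≡AP'N))
    lift : ∀ {p'} → p' ∈ AP g' δ' N → ∃ λ p → p ∈ AP (ι g') (ι δ') M × π p ≡ p'
    lift {p'} p'∈ with P'.∈-AP⁻ M (subst (p' ∈_) (sym AP'M≡AP'N) p'∈)
    ... | i , i<M , refl = P.term i , P.∈-AP⁺ i i<M , π-term i

  module Image (A : Subset n) (closed : ∀ x y → toℕ x % d ≡ toℕ y % d → x ∈ 2· A → y ∈ 2· A) where

    private
      image? : (y : ℤ/ k) → Dec (∃ λ a → a ∈ A × π a ≡ y)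
      image? y = any? (λ a → (a ∈? A) ×-dec (π a ≟ᶠ y))

    A' : Subset d
    A' = tabulate (λ y → ⌊ image? y ⌋)

    ∈A'⁺ : ∀ {a} → a ∈ A → π a ∈ A'
    ∈A'⁺ {a} a∈ = ∈-tabulate⁺ image? (a , a∈ , refl)

    ∈A'⁻ : ∀ {y} → y ∈ A' → ∃ λ a → a ∈ A × π a ≡ y
    ∈A'⁻ = ∈-tabulate⁻ image?

    2A≡π⁻¹2A' : 2· A ≡ π⁻¹ (2· A')
    2A≡π⁻¹2A' = ⊆-antisym 2A⊆π⁻¹2A' π⁻¹2A'⊆2A
      where
      2A⊆π⁻¹2A' : 2· A ⊆ π⁻¹ (2· A')
      2A⊆π⁻¹2A' {x} x∈ =
        let (a , b , a∈ , b∈ , a⊕b≡x) = ∈-2·⁻ {S = A} x∈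
        in ∈π⁻¹⁺ {2· A'} {x} (subst (_∈ 2· A') (trans (sym (π-⊕ a b)) (cong π a⊕b≡x))
                                   (∈-2·⁺ {S = A'} (∈A'⁺ a∈) (∈A'⁺ b∈)))
      π⁻¹2A'⊆2A : π⁻¹ (2· A') ⊆ 2· A
      π⁻¹2A'⊆2A {x} x∈ =
        let (a' , b' , a'∈ , b'∈ , a'⊕b'≡πx) = ∈-2·⁻ {S = A'} (∈π⁻¹⁻ (2· A') x∈)
            (a , a∈ , πa≡a') = ∈A'⁻ a'∈
            (b , b∈ , πb≡b') = ∈A'⁻ b'∈
        in closed (a ⊕ b) x (π-≡⇒%-≡ {a ⊕ b} {x} (trans (π-⊕ a b) (trans (cong₂ _⊕_ πa≡a' πb≡b') a'⊕b'≡πx)))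
                  (∈-2·⁺ {S = A} a∈ b∈)

    ∣2A∣≡h*∣2A'∣ : ∣ 2· A ∣ ≡ h * ∣ 2· A' ∣
    ∣2A∣≡h*∣2A'∣ = trans (cong ∣_∣ 2A≡π⁻¹2A') (∣π⁻¹∣ (2· A'))

    ∣A∣≤h*∣A'∣ : ∣ A ∣ ≤ h * ∣ A' ∣
    ∣A∣≤h*∣A'∣ = subst (∣ A ∣ ≤_) (∣π⁻¹∣ A') (p⊆q⇒∣p∣≤∣q∣ (∈π⁻¹⁺ ∘ ∈A'⁺))

    private
      h*-comm : ∀ h c u → h * (c * u) ≡ c * (h * u)
      h*-comm = solve-∀

    reduce-doubling : ∀ c₁ c₂ → c₁ * ∣ 2· A ∣ < c₂ * ∣ A ∣ → c₁ * ∣ 2· A' ∣ < c₂ * ∣ A' ∣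
    reduce-doubling c₁ c₂ lt = *-cancelˡ-< h (c₁ * ∣ 2· A' ∣) (c₂ * ∣ A' ∣) (begin-strict
      h * (c₁ * ∣ 2· A' ∣) ≡⟨ h*-comm h c₁ _ ⟩
      c₁ * (h * ∣ 2· A' ∣) ≡⟨ cong (c₁ *_) ∣2A∣≡h*∣2A'∣ ⟨
      c₁ * ∣ 2· A ∣        <⟨ lt ⟩
      c₂ * ∣ A ∣           ≤⟨ *-monoʳ-≤ c₂ ∣A∣≤h*∣A'∣ ⟩
      c₂ * (h * ∣ A' ∣)    ≡⟨ h*-comm h c₂ _ ⟨
      h * (c₂ * ∣ A' ∣)    ∎)
      where open ≤-Reasoning

    reduce-small : ∣ 2· A ∣ < n → ∣ 2· A' ∣ < d
    reduce-small lt = *-cancelˡ-< h ∣ 2· A' ∣ d (subst₂ _<_ ∣2A∣≡h*∣2A'∣ n≡h*d lt)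

    scale-CaseI : ∀ c → d + c * ∣ A' ∣ ≤ c * ∣ 2· A' ∣ → n + c * ∣ A ∣ ≤ c * ∣ 2· A ∣
    scale-CaseI c caseI = begin
      n + c * ∣ A ∣             ≤⟨ +-mono-≤ (≤-reflexive n≡h*d) (*-monoʳ-≤ c ∣A∣≤h*∣A'∣) ⟩
      h * d + c * (h * ∣ A' ∣)  ≡⟨ distribute h d c ∣ A' ∣ ⟩
      h * (d + c * ∣ A' ∣)      ≤⟨ *-monoʳ-≤ h caseI ⟩
      h * (c * ∣ 2· A' ∣)       ≡⟨ h*-comm h c _ ⟩
      c * (h * ∣ 2· A' ∣)       ≡⟨ cong (c *_) ∣2A∣≡h*∣2A'∣ ⟨
      c * ∣ 2· A ∣              ∎
      where
      open ≤-Reasoning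
      distribute : ∀ h d c v → h * d + c * (h * v) ≡ h * (d + c * v)
      distribute = solve-∀

    -- Proved for an arbitrary c: with the literal C₀ = 24000 the checker unfolds the numeral.
    lift-CaseI : CaseI A' → CaseI A
    lift-CaseI = scale-CaseI C₀

    excess-π⁻¹ : ∀ e H' → e * ∣ H' ∣ + ∣ A' ∣ ≤ ∣ 2· A' ∣ → e * ∣ π⁻¹ H' ∣ + ∣ A ∣ ≤ ∣ 2· A ∣
    excess-π⁻¹ e H' le = begin
      e * ∣ π⁻¹ H' ∣ + ∣ A ∣         ≤⟨ +-mono-≤ (≤-reflexive (cong (e *_) (∣π⁻¹∣ H'))) ∣A∣≤h*∣A'∣ ⟩
      e * (h * ∣ H' ∣) + h * ∣ A' ∣  ≡⟨ distribute e h ∣ H' ∣ ∣ A' ∣ ⟩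
      h * (e * ∣ H' ∣ + ∣ A' ∣)      ≤⟨ *-monoʳ-≤ h le ⟩
      h * ∣ 2· A' ∣                  ≡⟨ ∣2A∣≡h*∣2A'∣ ⟨
      ∣ 2· A ∣                       ∎
      where
      open ≤-Reasoning
      distribute : ∀ e h s v → e * (h * s) + h * v ≡ h * (e * s + v)
      distribute = solve-∀

    lift-InCoset : (∃ λ H' → IsProperSubgroup H' × InCosetOf A' H') → ∃ λ H → IsProperSubgroup H × InCosetOf A H
    lift-InCoset (H' , H'<ℤ , g' , A'⊆g'+H') = π⁻¹ H' , π⁻¹-properSubgroup H'<ℤ , ι g' ,
      λ a a∈ → ∈π⁻¹-⊖⁺ a (ι g') (subst (λ z → (π a ⊖ z) ∈ H') (sym (π∘ι g')) (A'⊆g'+H' (π a) (∈A'⁺ a∈)))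

    lift-CaseII : CaseII A' → CaseII A
    lift-CaseII (H' , H'<ℤ , g' , δ' , N , 1<∣P'∣ , A'⊆P'+H' , excess) =
      π⁻¹ H' , π⁻¹-properSubgroup H'<ℤ , ι g' , ι δ' , M
      , subst (1 <_) (sym ∣AP∣≡∣AP'∣) 1<∣P'∣
      , A⊆P+π⁻¹H'
      , subst (λ s → (s ∸ 1) * ∣ π⁻¹ H' ∣ + ∣ A ∣ ≤ ∣ 2· A ∣) (sym ∣AP∣≡∣AP'∣)
              (excess-π⁻¹ (∣ AP g' δ' N ∣ ∸ 1) H' excess)
      where
      open LiftedAP (lift-AP g' δ' N)
      A⊆P+π⁻¹H' : ∀ a → a ∈ A → ∃ λ p → ∃ λ q → p ∈ AP (ι g') (ι δ') M × q ∈ π⁻¹ H' × a ≡ p ⊕ q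
      A⊆P+π⁻¹H' a a∈ =
        let (p' , h' , p'∈ , h'∈ , πa≡p'⊕h') = A'⊆P'+H' (π a) (∈A'⁺ a∈)
            (p , p∈ , πp≡p') = lift p'∈
            πa⊖πp≡h' = trans (cong₂ _⊖_ πa≡p'⊕h' πp≡p') ([p⊕h]⊖p≡h p' h')
        in p , a ⊖ p , p∈ , ∈π⁻¹-⊖⁺ a p (subst (_∈ H') (sym πa⊖πp≡h') h'∈) , sym (p⊕[a⊖p]≡a p a)

    lift-CaseIII-cosets : ∀ {H'} x y z → CaseIII-cosets A' H' (π x) (π y) (π z) → CaseIII-cosets A (π⁻¹ H') x y z
    lift-CaseIII-cosets {H'} x y z (x'≁y' , x'≁z' , y'≁z' , cover , ¬AP , excess) =
      x'≁y' ∘ ∈π⁻¹-⊖⁻ H' x y , x'≁z' ∘ ∈π⁻¹-⊖⁻ H' x z , y'≁z' ∘ ∈π⁻¹-⊖⁻ H' y z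
      , (λ a a∈ → ⊎-map (∈π⁻¹-⊖⁺ a x) (⊎-map (∈π⁻¹-⊖⁺ a y) (∈π⁻¹-⊖⁺ a z)) (cover (π a) (∈A'⁺ a∈)))
      , ¬AP ∘ π-CosetsFormAP {H'} {x} {y} {z}
      , excess-π⁻¹ 3 H' excess

    lift-CaseIII : CaseIII A' → CaseIII A
    lift-CaseIII (H' , H'<ℤ , x' , y' , z' , x'∈ , y'∈ , z'∈ , cosets) =
      lift-representatives (∈A'⁻ x'∈) (∈A'⁻ y'∈) (∈A'⁻ z'∈) cosets
      where
      lift-representatives : ∀ {x' y' z'} → (∃ λ x → x ∈ A × π x ≡ x') → (∃ λ y → y ∈ A × π y ≡ y')
        → (∃ λ z → z ∈ A × π z ≡ z') → CaseIII-cosets A' H' x' y' z' → CaseIII A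
      lift-representatives (x , x∈ , refl) (y , y∈ , refl) (z , z∈ , refl) cosets' =
        π⁻¹ H' , π⁻¹-properSubgroup H'<ℤ , x , y , z , x∈ , y∈ , z∈ , lift-CaseIII-cosets x y z cosets'

    reduce-counterexample : Counterexample A → Counterexample A'
    reduce-counterexample (¬coset , doubling , small , ¬I , ¬II , ¬III) =
      ¬coset ∘ lift-InCoset , reduce-doubling 4 9 doubling , reduce-small small ,
      ¬I ∘ lift-CaseI , ¬II ∘ lift-CaseII , ¬III ∘ lift-CaseIII

lemma12 : (m : ℕ) (A : Subset (suc m)) → Counterexample A
    → (∀ (k : ℕ) → k < m → (B : Subset (suc k)) → ¬ Counterexample B)
    → Aperiodic (2· A)
lemma12 m A counterexample minimal g 2A+g≡2A = decidable-stable (g ≟ᶠ Fin.zero) nonzero-period-impossible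
  where
  nonzero-period-impossible : ¬ g ≢ Fin.zero
  nonzero-period-impossible g≢0 = minimal k k<m A' (reduce-counterexample counterexample)
    where
    open ResidueDetermined (Shift.period⇒residueDetermined (2· A) g g≢0 2A+g≡2A)
    open Reduction m k h n≡h*d
    open Image A closed
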